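{- Consider the algorithm described in the context, applied to a bipartite graph $G=(A\cup B,E)$ with $V_p\subseteq A$. At no point does the algorithm create a fixed $v$-path for any priceable vertex $v\in V_p$.
   Context: Setting: bipartite graph $G=(A\cup B,E)$, $E\subseteq A\times B$, vertices partitioned into priceable $V_p\subseteq A$ (prices $p(v)\ge0$) and fixed-price $V_f$ (costs $c(v)\ge0$). The flow network $G_d$ adds a source $s$ with directed edges $(s,v)$ for all $v\in A$ and a sink $t$ with directed edges $(v,t)$ for all $v\in B$; edge $(s,v)$ or $(v,t)$ has capacity $p(v)$ if $v\in V_p$ and $c(v)$ if $v\in V_f$; original edges are directed from $A$ to $B$ with infinite capacity. An augmenting path (w.r.t. the current flow) traverses forward edges with slack capacity and backward edges with nonzero flow. For $v\in V_p$, a fixed $v$-path is an augmenting path from $s$ to $v$ that starts with an edge $(s,u)$ for a fixed-price vertex $u\in V_f$ and reaches $v$ by traversing backward (decreasing flow on) an original edge $(v,w)$, $w\in B$. Algorithm: (1) construct $G_d$; (2) set $p(v)=0$ for all $v\in V_p$; (3) compute a maximum $s$-$t$-flow $\phi$ in $G_d$; (4) while there is $v\in V_p$ such that increasing $p(v)$ yields an augmenting $s$-$t$-path $P$, increase $p(v)$ and $\phi$ along $P$ as much as possible.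
   Formalization: The costs $c(v)$ are rational, so the prices $p(v)$ and the flow $\phi$ take rational values too. -}

module Defs where

open import Data.Nat using (ℕ; zero; suc)
open import Data.Fin using (Fin; zero; suc)
open import Data.Fin.Properties using () renaming (_≟_ to _≟ᶠ_)
open import Data.Bool using (Bool; true; false; if_then_else_; _∧_)
open import Data.Maybe using (Maybe; just; nothing)
open import Data.Rational using (ℚ; 0ℚ; _+_; _-_; _≤_; _<_; _⊓_)
open import Data.List using (List; []; _∷_; _++_; [_])
open import Data.List.Relation.Unary.Unique.Propositional using (Unique)
open import Data.Product using (Σ; ∃; _×_; _,_)
open import Relation.Binary.PropositionalEquality using (_≡_)
open import Relation.Nullary using (¬_)
open import Relation.Nullary.Decidable using (⌊_⌋)

sumFin : ∀ {n} → (Fin n → ℚ) → ℚ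
sumFin {zero} f = 0ℚ
sumFin {suc n} f = f zero + sumFin (λ i → f (suc i))

-- A problem instance: bipartite graph with A = Fin nA, B = Fin nB,
-- E ⊆ A × B given by a Boolean adjacency function, the set of
-- priceable vertices V_p ⊆ A (all other vertices are fixed-price),
-- and nonnegative costs. (cA i is only used when i is fixed-price.)
record Instance : Set where
  field
    nA nB     : ℕ
    E         : Fin nA → Fin nB → Bool
    priceable : Fin nA → Bool
    cA        : Fin nA → ℚ
    cB        : Fin nB → ℚ
    cA≥0      : ∀ i → 0ℚ ≤ cA i
    cB≥0      : ∀ j → 0ℚ ≤ cB j

module _ (I : Instance) where
  open Instance I

  Prices : Set
  Prices = Fin nA → ℚ

  -- A flow in G_d: fs i on (s, i), fe i j on (i, j), ft j on (j, t).
  record Flow : Set where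
    constructor flow
    field
      fs : Fin nA → ℚ
      fe : Fin nA → Fin nB → ℚ
      ft : Fin nB → ℚ
  open Flow public

  capS : Prices → Fin nA → ℚ
  capS p i = if priceable i then p i else cA i

  -- feasible s-t flow in G_d with prices p (original edges have infinite capacity)
  record Feasible (p : Prices) (φ : Flow) : Set where
    field
      fs-nonneg : ∀ i → 0ℚ ≤ fs φ i
      fs-cap    : ∀ i → fs φ i ≤ capS p i
      ft-nonneg : ∀ j → 0ℚ ≤ ft φ j
      ft-cap    : ∀ j → ft φ j ≤ cB j
      fe-nonneg : ∀ i j → 0ℚ ≤ fe φ i j
      fe-nonedge : ∀ i j → E i j ≡ false → fe φ i j ≡ 0ℚ
      cons-A    : ∀ i → fs φ i ≡ sumFin (fe φ i)
      cons-B    : ∀ j → ft φ j ≡ sumFin (λ i → fe φ i j)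

  value : Flow → ℚ
  value φ = sumFin (ft φ)

  MaxFlow : Prices → Flow → Set
  MaxFlow p φ = Feasible p φ × (∀ ψ → Feasible p ψ → value ψ ≤ value φ)

  data Node : Set where
    src snk : Node
    a : Fin nA → Node
    b : Fin nB → Node

  data Arc (p : Prices) (φ : Flow) : Node → Node → Set where
    fwdS : ∀ i → fs φ i < capS p i → Arc p φ src (a i)
    bwdS : ∀ i → 0ℚ < fs φ i → Arc p φ (a i) src
    fwdE : ∀ i j → E i j ≡ true → Arc p φ (a i) (b j)
    bwdE : ∀ i j → E i j ≡ true → 0ℚ < fe φ i j → Arc p φ (b j) (a i)
    fwdT : ∀ j → ft φ j < cB j → Arc p φ (b j) snk
    bwdT : ∀ j → 0ℚ < ft φ j → Arc p φ snk (b j)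

  data Walk (p : Prices) (φ : Flow) : Node → Node → List Node → Set where
    here : ∀ {x} → Walk p φ x x [ x ]
    step : ∀ {x y z ns} → Arc p φ x y → Walk p φ y z ns → Walk p φ x z (x ∷ ns)

  -- residual capacity of an arc (nothing = infinite)
  resid : ∀ {p φ x y} → Arc p φ x y → Maybe ℚ
  resid {p} {φ} (fwdS i _)   = just (capS p i - fs φ i)
  resid {p} {φ} (bwdS i _)   = just (fs φ i)
  resid (fwdE i j _)         = nothing
  resid {p} {φ} (bwdE i j _ _) = just (fe φ i j)
  resid {p} {φ} (fwdT j _)   = just (cB j - ft φ j)
  resid {p} {φ} (bwdT j _)   = just (ft φ j)

  minM : Maybe ℚ → Maybe ℚ → Maybe ℚ
  minM (just x) (just y) = just (x ⊓ y)
  minM (just x) nothing  = just x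
  minM nothing  m        = m

  bottleneck : ∀ {p φ x y ns} → Walk p φ x y ns → Maybe ℚ
  bottleneck here       = nothing
  bottleneck (step e w) = minM (resid e) (bottleneck w)

  updA : ∀ {n} → (Fin n → ℚ) → Fin n → ℚ → Fin n → ℚ
  updA f i x k = if ⌊ k ≟ᶠ i ⌋ then x else f k

  updE : (Fin nA → Fin nB → ℚ) → Fin nA → Fin nB → ℚ → Fin nA → Fin nB → ℚ
  updE f i j x k l = if ⌊ k ≟ᶠ i ⌋ ∧ ⌊ l ≟ᶠ j ⌋ then x else f k l

  pushArc : ∀ {p φ x y} → ℚ → Arc p φ x y → Flow → Flow
  pushArc δ (fwdS i _)     (flow s e t) = flow (updA s i (s i + δ)) e t
  pushArc δ (bwdS i _)     (flow s e t) = flow (updA s i (s i - δ)) e t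
  pushArc δ (fwdE i j _)   (flow s e t) = flow s (updE e i j (e i j + δ)) t
  pushArc δ (bwdE i j _ _) (flow s e t) = flow s (updE e i j (e i j - δ)) t
  pushArc δ (fwdT j _)     (flow s e t) = flow s e (updA t j (t j + δ))
  pushArc δ (bwdT j _)     (flow s e t) = flow s e (updA t j (t j - δ))

  pushS : ℚ → Fin nA → Flow → Flow
  pushS δ i (flow s e t) = flow (updA s i (s i + δ)) e t

  push : ∀ {p φ x y ns} → ℚ → Walk p φ x y ns → Flow → Flow
  push δ here       ψ = ψ
  push δ (step e w) ψ = push δ w (pushArc δ e ψ)

  -- A fixed v-path: a (simple) augmenting path from s to v starting with
  -- an edge (s,u), u fixed-price, and reaching v via a backward original
  -- edge (v,w), w ∈ B.
  FixedPath : Prices → Flow → Fin nA → Set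
  FixedPath p φ v =
    Σ (Fin nA) λ u → Σ (Fin nB) λ w → Σ (List Node) λ ms →
      priceable u ≡ false ×
      Arc p φ src (a u) ×
      Walk p φ (a u) (b w) ms ×
      Arc p φ (b w) (a v) ×
      Unique (src ∷ ms ++ [ a v ])

  zeroPrices : Prices
  zeroPrices _ = 0ℚ

  -- One iteration of step (4): for priceable v, there is a simple augmenting
  -- path P = s → v → ... → t once p(v) is increased, i.e. a simple residual
  -- walk from v to t (avoiding s) w.r.t. φ; let δ be its bottleneck (the
  -- maximum amount by which flow can be pushed along P when (s,v) is no
  -- longer limiting).
  data Step : Prices → Flow → Prices → Flow → Set where
    augment : ∀ {p φ} (v : Fin nA) → priceable v ≡ true →
              ∀ {ns} (w : Walk p φ (a v) snk ns) → Unique (src ∷ ns) →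
              ∀ {δ} → bottleneck w ≡ just δ →
              Step p φ (updA p v (p v + δ))
                       (push δ w (pushS δ v φ))

  -- states (prices, flow) reachable by the algorithm: after steps (1)-(3)
  -- (p = 0, φ a maximum flow) and any number of iterations of step (4)
  data Reachable : Prices → Flow → Set where
    start : ∀ φ → MaxFlow zeroPrices φ → Reachable zeroPrices φ
    next  : ∀ {p φ p' φ'} → Reachable p φ → Step p φ p' φ' → Reachable p' φ'

-- The algorithm maintains a set S of nodes of G_d that contains s but neither t
-- nor any priceable vertex, and that is closed under residual arcs. Initially S
-- is the residual reachability set of s: it misses t because φ is maximum, and
-- it misses every priceable vertex, which has price 0 and hence no entering
-- residual arc. An iteration of step (4) pushes flow along a path from v to t;
-- by closedness that path lies outside S, so the residual arcs leaving S are
-- unaffected, except (s, v), which keeps its slack because price and flow grow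
-- by the same amount. A fixed v-path is a residual path from s to v, so it
-- would put v into S.
--
-- That a maximum flow has no simple augmenting path is shown by induction on
-- the path. A path s → u → w → t is augmented directly. On s → u → w ← i → …,
-- u first takes over part of the flow that i sends into w; this keeps the value
-- and creates slack on (s, i) for the rest of the path.
module Submission where

open import Defs
import Data.Nat as ℕ
open import Data.Fin using (Fin; zero; suc)
open import Data.Fin.Properties using () renaming (_≟_ to _≟ᶠ_)
open import Data.Bool using (true; false; if_then_else_)
open import Data.Rational using (ℚ; 0ℚ; _+_; _-_; -_; _≤_; _<_; _⊓_)
open import Data.Rational.Properties
open import Data.Rational.Solver using (module +-*-Solver)
open import Data.List using (List; []; _∷_; _++_; [_])
open import Data.List.Membership.Propositional using (_∈_; _∉_)
open import Data.List.Relation.Unary.Any using (here; there)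
open import Data.List.Relation.Unary.All using (All; []; _∷_; lookup)
open import Data.List.Relation.Unary.All.Properties using (¬Any⇒All¬)
open import Data.List.Relation.Unary.AllPairs using ([]; _∷_)
open import Data.List.Relation.Unary.Unique.Propositional using (Unique)
open import Data.Product using (Σ; _×_; _,_; proj₁)
open import Data.Sum using (inj₁; inj₂)
open import Data.Empty using (⊥-elim)
open import Function using (_∘_)
open import Relation.Binary.Definitions using (DecidableEquality)
open import Relation.Binary.PropositionalEquality hiding ([_])
open import Relation.Nullary using (¬_; Dec; yes; no; contradiction)
open import Relation.Nullary.Decidable using (map′)

open +-*-Solver

p≤p+q : ∀ p {q} → 0ℚ ≤ q → p ≤ p + q
p≤p+q p 0≤q = subst (_≤ p + _) (+-identityʳ p) (+-monoʳ-≤ p 0≤q)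

p<p+q : ∀ p {q} → 0ℚ < q → p < p + q
p<p+q p 0<q = subst (_< p + _) (+-identityʳ p) (+-monoʳ-< p 0<q)

p-q≤p : ∀ p {q} → 0ℚ ≤ q → p - q ≤ p
p-q≤p p 0≤q = subst (p - _ ≤_) (+-identityʳ p) (+-monoʳ-≤ p (neg-antimono-≤ 0≤q))

p-q<p : ∀ p {q} → 0ℚ < q → p - q < p
p-q<p p 0<q = subst (p - _ <_) (+-identityʳ p) (+-monoʳ-< p (neg-antimono-< 0<q))

p≤q⇒0≤q-p : ∀ {p q} → p ≤ q → 0ℚ ≤ q - p
p≤q⇒0≤q-p {p} {q} p≤q = subst (_≤ q - p) (+-inverseʳ p) (+-monoˡ-≤ (- p) p≤q)

p<q⇒0<q-p : ∀ {p q} → p < q → 0ℚ < q - p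
p<q⇒0<q-p {p} {q} p<q = subst (_< q - p) (+-inverseʳ p) (+-monoˡ-< (- p) p<q)

q≤r-p⇒p+q≤r : ∀ p {q r} → q ≤ r - p → p + q ≤ r
q≤r-p⇒p+q≤r p {q} {r} h =
  subst (p + q ≤_) (solve 2 (λ p r → p :+ (r :- p) := r) refl p r) (+-monoʳ-≤ p h)

+-cancelʳ-< : ∀ {p q} r → p + r < q + r → p < q
+-cancelʳ-< {p} {q} r h = subst₂ _<_ (cancel p) (cancel q) (+-monoˡ-< (- r) h)
  where
  cancel : ∀ x → x + r - r ≡ x
  cancel x = solve 2 (λ x r → x :+ r :- r := x) refl x r

0<p⊓q : ∀ {p q} → 0ℚ < p → 0ℚ < q → 0ℚ < p ⊓ q
0<p⊓q {p} {q} 0<p 0<q with ⊓-sel p q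
... | inj₁ p⊓q≡p = subst (0ℚ <_) (sym p⊓q≡p) 0<p
... | inj₂ p⊓q≡q = subst (0ℚ <_) (sym p⊓q≡q) 0<q

sumFin-zero : ∀ {n} → sumFin {n} (λ _ → 0ℚ) ≡ 0ℚ
sumFin-zero {ℕ.zero} = refl
sumFin-zero {ℕ.suc n} = trans (+-identityˡ _) (sumFin-zero {n})

sumFin-+ : ∀ {n} (f g : Fin n → ℚ) → sumFin (λ i → f i + g i) ≡ sumFin f + sumFin g
sumFin-+ {ℕ.zero} f g = refl
sumFin-+ {ℕ.suc n} f g =
  trans (cong (f zero + g zero +_) (sumFin-+ (f ∘ suc) (g ∘ suc)))
        (solve 4 (λ a b c d → (a :+ b) :+ (c :+ d) := (a :+ c) :+ (b :+ d)) refl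
           (f zero) (g zero) (sumFin (f ∘ suc)) (sumFin (g ∘ suc)))

sumFin-nonneg : ∀ {n} (f : Fin n → ℚ) → (∀ i → 0ℚ ≤ f i) → 0ℚ ≤ sumFin f
sumFin-nonneg {ℕ.zero} f f≥0 = ≤-refl
sumFin-nonneg {ℕ.suc n} f f≥0 =
  ≤-trans (f≥0 zero) (p≤p+q (f zero) (sumFin-nonneg (f ∘ suc) (f≥0 ∘ suc)))

≤-sumFin : ∀ {n} (f : Fin n → ℚ) → (∀ i → 0ℚ ≤ f i) → ∀ j → f j ≤ sumFin f
≤-sumFin {ℕ.suc n} f f≥0 zero = p≤p+q (f zero) (sumFin-nonneg (f ∘ suc) (f≥0 ∘ suc))
≤-sumFin {ℕ.suc n} f f≥0 (suc j) =
  ≤-trans (≤-sumFin (f ∘ suc) (f≥0 ∘ suc) j)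
          (subst (_≤ f zero + sumFin (f ∘ suc)) (+-identityˡ (sumFin (f ∘ suc)))
                 (+-monoˡ-≤ (sumFin (f ∘ suc)) (f≥0 zero)))

pointMass : ∀ {n} → Fin n → ℚ → Fin n → ℚ
pointMass zero    x zero    = x
pointMass zero    x (suc k) = 0ℚ
pointMass (suc i) x zero    = 0ℚ
pointMass (suc i) x (suc k) = pointMass i x k

pointMass-≡ : ∀ {n} (i : Fin n) x → pointMass i x i ≡ x
pointMass-≡ zero    x = refl
pointMass-≡ (suc i) x = pointMass-≡ i x

pointMass-≢ : ∀ {n} {k i : Fin n} x → k ≢ i → pointMass i x k ≡ 0ℚ
pointMass-≢ {k = zero}  {zero}  x k≢i = ⊥-elim (k≢i refl)
pointMass-≢ {k = zero}  {suc i} x k≢i = refl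
pointMass-≢ {k = suc k} {zero}  x k≢i = refl
pointMass-≢ {k = suc k} {suc i} x k≢i = pointMass-≢ x (k≢i ∘ cong suc)

sumFin-pointMass : ∀ {n} (i : Fin n) x → sumFin (pointMass i x) ≡ x
sumFin-pointMass {ℕ.suc n} zero    x = trans (cong (x +_) (sumFin-zero {n})) (+-identityʳ x)
sumFin-pointMass         (suc i) x = trans (+-identityˡ _) (sumFin-pointMass i x)

sumFin-pointMass-comm : ∀ {m n} (j : Fin n) (d : Fin m → ℚ) l →
                        sumFin (λ k → pointMass j (d k) l) ≡ pointMass j (sumFin d) l
sumFin-pointMass-comm zero    d zero    = refl
sumFin-pointMass-comm {m} zero    d (suc l) = sumFin-zero {m}
sumFin-pointMass-comm {m} (suc j) d zero    = sumFin-zero {m}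
sumFin-pointMass-comm (suc j) d (suc l) = sumFin-pointMass-comm j d l

pointMass-zero : ∀ {n} (i k : Fin n) → pointMass i 0ℚ k ≡ 0ℚ
pointMass-zero zero    zero    = refl
pointMass-zero zero    (suc k) = refl
pointMass-zero (suc i) zero    = refl
pointMass-zero (suc i) (suc k) = pointMass-zero i k

+-pointMass-≡ : ∀ {n} x (i : Fin n) y → x + pointMass i y i ≡ x + y
+-pointMass-≡ x i y = cong (x +_) (pointMass-≡ i y)

+-pointMass-≢ : ∀ {n} x {k i : Fin n} y → k ≢ i → x + pointMass i y k ≡ x
+-pointMass-≢ x y k≢i = trans (cong (x +_) (pointMass-≢ y k≢i)) (+-identityʳ x)

shiftMass : ∀ {n} → Fin n → Fin n → ℚ → Fin n → ℚ
shiftMass i u x k = pointMass u x k + pointMass i (- x) k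

sumFin-shiftMass : ∀ {n} (i u : Fin n) x → sumFin (shiftMass i u x) ≡ 0ℚ
sumFin-shiftMass i u x = begin
  sumFin (shiftMass i u x)
    ≡⟨ sumFin-+ (pointMass u x) (pointMass i (- x)) ⟩
  sumFin (pointMass u x) + sumFin (pointMass i (- x))
    ≡⟨ cong₂ _+_ (sumFin-pointMass u x) (sumFin-pointMass i (- x)) ⟩
  x - x
    ≡⟨ +-inverseʳ x ⟩
  0ℚ ∎
  where open ≡-Reasoning

shiftMass-source : ∀ {n} {i u : Fin n} x → u ≢ i → shiftMass i u x i ≡ - x
shiftMass-source {i = i} x u≢i =
  trans (cong₂ _+_ (pointMass-≢ x (u≢i ∘ sym)) (pointMass-≡ i (- x))) (+-identityˡ (- x))

module _ (I : Instance) where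
  open Instance I

  _≟ₙ_ : DecidableEquality (Node I)
  src ≟ₙ src = yes refl
  src ≟ₙ snk = no λ ()
  src ≟ₙ a _ = no λ ()
  src ≟ₙ b _ = no λ ()
  snk ≟ₙ src = no λ ()
  snk ≟ₙ snk = yes refl
  snk ≟ₙ a _ = no λ ()
  snk ≟ₙ b _ = no λ ()
  a _ ≟ₙ src = no λ ()
  a _ ≟ₙ snk = no λ ()
  a i ≟ₙ a j = map′ (cong a) (λ { refl → refl }) (i ≟ᶠ j)
  a _ ≟ₙ b _ = no λ ()
  b _ ≟ₙ src = no λ ()
  b _ ≟ₙ snk = no λ ()
  b _ ≟ₙ a _ = no λ ()
  b i ≟ₙ b j = map′ (cong b) (λ { refl → refl }) (i ≟ᶠ j)

  open import Data.List.Membership.DecPropositional _≟ₙ_ using (_∈?_)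

  capS-priceable : ∀ (p : Prices I) {v} → priceable v ≡ true → capS I p v ≡ p v
  capS-priceable p {v} pv = cong (if_then p v else cA v) pv

  -- Residual walks

  module _ {p : Prices I} {φ : Flow I} where

    headIn : ∀ {x y ns} → Walk I p φ x y ns → x ∈ ns
    headIn here       = here refl
    headIn (step _ _) = here refl

    snoc : ∀ {x y z ns} → Walk I p φ x y ns → Arc I p φ y z → Walk I p φ x z (ns ++ [ z ])
    snoc here       e = step e here
    snoc (step d w) e = step d (snoc w e)

    suffixFrom : ∀ {x y z ns} → Walk I p φ y z ns → Unique ns → x ∈ ns →
                 Σ (List (Node I)) λ ms → Walk I p φ x z ms × Unique ms
    suffixFrom here       U       (here refl) = _ , here , U
    suffixFrom (step e w) U       (here refl) = _ , step e w , U
    suffixFrom (step e w) (_ ∷ U) (there m)   = suffixFrom w U m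

    simplify : ∀ {x z ns} → Walk I p φ x z ns → Σ (List (Node I)) λ ms → Walk I p φ x z ms × Unique ms
    simplify here = _ , here , [] ∷ []
    simplify {x} (step e w) with simplify w
    ... | ms , w′ , U with x ∈? ms
    ...   | yes x∈ms = suffixFrom w′ U x∈ms
    ...   | no  x∉ms = x ∷ ms , step e w′ , ¬Any⇒All¬ ms x∉ms ∷ U

    walk-closed : {S : Node I → Set} → (∀ {x y} → Arc I p φ x y → S x → S y) →
                  ∀ {x y ns} → Walk I p φ x y ns → S x → S y
    walk-closed closed here       sx = sx
    walk-closed closed (step e w) sx = walk-closed closed w (closed e sx)

    walk-avoids : {S : Node I → Set} → (∀ {x y} → Arc I p φ x y → S x → S y) →
                  ∀ {x y ns} → ¬ S y → Walk I p φ x y ns → All (¬_ ∘ S) ns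
    walk-avoids closed ¬sy here       = ¬sy ∷ []
    walk-avoids {S} closed ¬sy (step {ns = ns} e w) = (λ sx → lookup rest (headIn w) (closed e sx)) ∷ rest
      where
      rest : All (¬_ ∘ S) ns
      rest = walk-avoids closed ¬sy w

    noArcInto⇒walk-trivial : ∀ {x y ns} → (∀ {z} → ¬ Arc I p φ z y) → Walk I p φ x y ns → x ≡ y
    noArcInto⇒walk-trivial noArc here = refl
    noArcInto⇒walk-trivial noArc (step e w) with noArcInto⇒walk-trivial noArc w
    ... | refl = ⊥-elim (noArc e)

  walk-transport : ∀ {p φ ψ x y ns} → Walk I p φ x y ns → src ∉ ns →
                   (∀ k l → b l ∈ ns → fe ψ k l ≡ fe φ k l) →
                   (∀ l → b l ∈ ns → ft ψ l ≡ ft φ l) → Walk I p ψ x y ns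
  walk-transport here _ _ _ = here
  walk-transport (step (fwdS _ _) w) src∉ _ _ = ⊥-elim (src∉ (here refl))
  walk-transport (step (bwdS _ _) w) src∉ _ _ = ⊥-elim (src∉ (there (headIn w)))
  walk-transport (step (fwdE k l e) w) src∉ fe≡ ft≡ =
    step (fwdE k l e) (walk-transport w (src∉ ∘ there) (λ k l → fe≡ k l ∘ there) (λ l → ft≡ l ∘ there))
  walk-transport (step (bwdE k l e 0<fe) w) src∉ fe≡ ft≡ =
    step (bwdE k l e (subst (0ℚ <_) (sym (fe≡ k l (here refl))) 0<fe))
         (walk-transport w (src∉ ∘ there) (λ k l → fe≡ k l ∘ there) (λ l → ft≡ l ∘ there))
  walk-transport (step (fwdT l ft<c) w) src∉ fe≡ ft≡ =
    step (fwdT l (subst (_< cB l) (sym (ft≡ l (here refl))) ft<c))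
         (walk-transport w (src∉ ∘ there) (λ k l → fe≡ k l ∘ there) (λ l → ft≡ l ∘ there))
  walk-transport (step (bwdT l 0<ft) w) src∉ fe≡ ft≡ =
    step (bwdT l (subst (0ℚ <_) (sym (ft≡ l (there (headIn w)))) 0<ft))
         (walk-transport w (src∉ ∘ there) (λ k l → fe≡ k l ∘ there) (λ l → ft≡ l ∘ there))

  -- Rerouting flow through a vertex of B

  reroute : Flow I → Fin nB → (Fin nA → ℚ) → Flow I
  reroute φ j d = flow (λ k → fs φ k + d k)
                       (λ k l → fe φ k l + pointMass j (d k) l)
                       (λ l → ft φ l + pointMass j (sumFin d) l)

  reroute-value : ∀ φ j d → value I (reroute φ j d) ≡ value I φ + sumFin d
  reroute-value φ j d =
    trans (sumFin-+ (ft φ) (pointMass j (sumFin d))) (cong (value I φ +_) (sumFin-pointMass j (sumFin d)))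

  -- x more units can be sent along s → a k → b j (x may be negative).
  record Admissible (p : Prices I) (φ : Flow I) (j : Fin nB) (k : Fin nA) (x : ℚ) : Set where
    field
      fs+x-nonneg : 0ℚ ≤ fs φ k + x
      fs+x≤cap    : fs φ k + x ≤ capS I p k
      fe+x-nonneg : 0ℚ ≤ fe φ k j + x
      nonedge⇒x≡0 : E k j ≡ false → x ≡ 0ℚ

  reroute-feasible : ∀ {p φ} j d → Feasible I p φ → (∀ k → Admissible p φ j k (d k)) →
                     0ℚ ≤ ft φ j + sumFin d → ft φ j + sumFin d ≤ cB j →
                     Feasible I p (reroute φ j d)
  reroute-feasible {p} {φ} j d F adm ft-lo ft-hi = record
    { fs-nonneg  = Admissible.fs+x-nonneg ∘ adm
    ; fs-cap     = Admissible.fs+x≤cap ∘ adm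
    ; ft-nonneg  = ft-nonneg′
    ; ft-cap     = ft-cap′
    ; fe-nonneg  = fe-nonneg′
    ; fe-nonedge = fe-nonedge′
    ; cons-A     = cons-A′
    ; cons-B     = cons-B′
    }
    where
    open Feasible F
    ft-nonneg′ : ∀ l → 0ℚ ≤ ft φ l + pointMass j (sumFin d) l
    ft-nonneg′ l with l ≟ᶠ j
    ... | yes refl = subst (0ℚ ≤_) (sym (+-pointMass-≡ (ft φ l) l (sumFin d))) ft-lo
    ... | no  l≢j  = subst (0ℚ ≤_) (sym (+-pointMass-≢ _ _ l≢j)) (ft-nonneg l)
    ft-cap′ : ∀ l → ft φ l + pointMass j (sumFin d) l ≤ cB l
    ft-cap′ l with l ≟ᶠ j
    ... | yes refl = subst (_≤ cB l) (sym (+-pointMass-≡ (ft φ l) l (sumFin d))) ft-hi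
    ... | no  l≢j  = subst (_≤ cB l) (sym (+-pointMass-≢ _ _ l≢j)) (ft-cap l)
    fe-nonneg′ : ∀ k l → 0ℚ ≤ fe φ k l + pointMass j (d k) l
    fe-nonneg′ k l with l ≟ᶠ j
    ... | yes refl = subst (0ℚ ≤_) (sym (+-pointMass-≡ (fe φ k l) l (d k))) (Admissible.fe+x-nonneg (adm k))
    ... | no  l≢j  = subst (0ℚ ≤_) (sym (+-pointMass-≢ _ _ l≢j)) (fe-nonneg k l)
    fe-nonedge′ : ∀ k l → E k l ≡ false → fe φ k l + pointMass j (d k) l ≡ 0ℚ
    fe-nonedge′ k l ¬e with l ≟ᶠ j
    ... | yes refl = trans (+-pointMass-≡ (fe φ k l) l (d k))
                           (cong₂ _+_ (fe-nonedge k l ¬e) (Admissible.nonedge⇒x≡0 (adm k) ¬e))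
    ... | no  l≢j  = trans (+-pointMass-≢ _ _ l≢j) (fe-nonedge k l ¬e)
    cons-A′ : ∀ k → fs φ k + d k ≡ sumFin (λ l → fe φ k l + pointMass j (d k) l)
    cons-A′ k = trans (cong₂ _+_ (cons-A k) (sym (sumFin-pointMass j (d k))))
                      (sym (sumFin-+ (fe φ k) (pointMass j (d k))))
    cons-B′ : ∀ l → ft φ l + pointMass j (sumFin d) l ≡ sumFin (λ k → fe φ k l + pointMass j (d k) l)
    cons-B′ l = trans (cong₂ _+_ (cons-B l) (sym (sumFin-pointMass-comm j d l)))
                      (sym (sumFin-+ (λ k → fe φ k l) (λ k → pointMass j (d k) l)))

  module _ {p : Prices I} {φ : Flow I} (F : Feasible I p φ) where
    open Feasible F

    fe≤fs : ∀ k j → fe φ k j ≤ fs φ k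
    fe≤fs k j = subst (fe φ k j ≤_) (sym (cons-A k)) (≤-sumFin (fe φ k) (fe-nonneg k) j)

    admissible-zero : ∀ j k → Admissible p φ j k 0ℚ
    admissible-zero j k = record
      { fs+x-nonneg = subst (0ℚ ≤_) (sym (+-identityʳ _)) (fs-nonneg k)
      ; fs+x≤cap    = subst (_≤ capS I p k) (sym (+-identityʳ _)) (fs-cap k)
      ; fe+x-nonneg = subst (0ℚ ≤_) (sym (+-identityʳ _)) (fe-nonneg k j)
      ; nonedge⇒x≡0 = λ _ → refl
      }

    admissible-increase : ∀ {j k x} → E k j ≡ true → 0ℚ ≤ x → x ≤ capS I p k - fs φ k →
                          Admissible p φ j k x
    admissible-increase {j} {k} e 0≤x x≤slack = record
      { fs+x-nonneg = ≤-trans (fs-nonneg k) (p≤p+q _ 0≤x)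
      ; fs+x≤cap    = q≤r-p⇒p+q≤r (fs φ k) x≤slack
      ; fe+x-nonneg = ≤-trans (fe-nonneg k j) (p≤p+q _ 0≤x)
      ; nonedge⇒x≡0 = λ ¬e → contradiction (trans (sym e) ¬e) λ ()
      }

    admissible-decrease : ∀ {j k x} → E k j ≡ true → 0ℚ ≤ x → x ≤ fe φ k j →
                          Admissible p φ j k (- x)
    admissible-decrease {j} {k} e 0≤x x≤fe = record
      { fs+x-nonneg = p≤q⇒0≤q-p (≤-trans x≤fe (fe≤fs k j))
      ; fs+x≤cap    = ≤-trans (p-q≤p _ 0≤x) (fs-cap k)
      ; fe+x-nonneg = p≤q⇒0≤q-p x≤fe
      ; nonedge⇒x≡0 = λ ¬e → contradiction (trans (sym e) ¬e) λ ()
      }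

    admissible-pointMass : ∀ {j u x} → Admissible p φ j u x → ∀ k → Admissible p φ j k (pointMass u x k)
    admissible-pointMass {j} {u} {x} adm k with k ≟ᶠ u
    ... | yes refl = subst (Admissible p φ j u) (sym (pointMass-≡ u x)) adm
    ... | no  k≢u  = subst (Admissible p φ j k) (sym (pointMass-≢ x k≢u)) (admissible-zero j k)

    admissible-shiftMass : ∀ {j i u x} → u ≢ i → Admissible p φ j u x → Admissible p φ j i (- x) →
                           ∀ k → Admissible p φ j k (shiftMass i u x k)
    admissible-shiftMass {j} {i} {u} {x} u≢i adm-u adm-i k with k ≟ᶠ u | k ≟ᶠ i
    ... | yes refl | _ = subst (Admissible p φ j u)
                               (sym (trans (cong₂ _+_ (pointMass-≡ u x) (pointMass-≢ (- x) u≢i)) (+-identityʳ x))) adm-u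
    ... | no k≢u | yes refl = subst (Admissible p φ j i) (sym (shiftMass-source x (k≢u ∘ sym))) adm-i
    ... | no k≢u | no k≢i = subst (Admissible p φ j k)
                                  (sym (cong₂ _+_ (pointMass-≢ x k≢u) (pointMass-≢ (- x) k≢i)))
                                  (admissible-zero j k)

  -- Augmenting paths

  Improvable : Prices I → Flow I → Set
  Improvable p φ = Σ (Flow I) λ ψ → Feasible I p ψ × value I φ < value I ψ

  improvable-resp-value : ∀ {p φ ψ} → value I ψ ≡ value I φ → Improvable p ψ → Improvable p φ
  improvable-resp-value ψ≡φ (χ , Fχ , gain) = χ , Fχ , subst (_< value I χ) ψ≡φ gain

  maxFlow⇒¬improvable : ∀ {p φ} → MaxFlow I p φ → ¬ Improvable p φ
  maxFlow⇒¬improvable (_ , max) (ψ , Fψ , gain) = <-irrefl refl (<-≤-trans gain (max ψ Fψ))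

  directPath⇒improvable : ∀ {p φ u j} → Feasible I p φ → fs φ u < capS I p u → E u j ≡ true →
                   ft φ j < cB j → Improvable p φ
  directPath⇒improvable {p} {φ} {u} {j} F fs<cap e ft<c =
    reroute φ j d , reroute-feasible j d F adm ft-lo ft-hi , gain
    where
    ε : ℚ
    ε = (capS I p u - fs φ u) ⊓ (cB j - ft φ j)
    0<ε : 0ℚ < ε
    0<ε = 0<p⊓q (p<q⇒0<q-p fs<cap) (p<q⇒0<q-p ft<c)
    d : Fin nA → ℚ
    d = pointMass u ε
    adm : ∀ k → Admissible p φ j k (d k)
    adm = admissible-pointMass F
            (admissible-increase F e (<⇒≤ 0<ε) (p⊓q≤p (capS I p u - fs φ u) (cB j - ft φ j)))
    ft-lo : 0ℚ ≤ ft φ j + sumFin d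
    ft-lo = subst (λ s → 0ℚ ≤ ft φ j + s) (sym (sumFin-pointMass u ε))
                  (≤-trans (Feasible.ft-nonneg F j) (p≤p+q _ (<⇒≤ 0<ε)))
    ft-hi : ft φ j + sumFin d ≤ cB j
    ft-hi = subst (λ s → ft φ j + s ≤ cB j) (sym (sumFin-pointMass u ε))
                  (q≤r-p⇒p+q≤r (ft φ j) (p⊓q≤q (capS I p u - fs φ u) (cB j - ft φ j)))
    gain : value I φ < value I (reroute φ j d)
    gain = subst (value I φ <_)
                 (sym (trans (reroute-value φ j d) (cong (value I φ +_) (sumFin-pointMass u ε))))
                 (p<p+q _ 0<ε)

  -- a u takes over ε of the flow that a i sends into b j, which frees capacity on (s, a i).
  exchange : Fin nA → Fin nA → Fin nB → ℚ → Flow I → Flow I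
  exchange i u j ε φ = reroute φ j (shiftMass i u ε)

  module _ (i u : Fin nA) (j : Fin nB) (ε : ℚ) (φ : Flow I) where

    exchange-value : value I (exchange i u j ε φ) ≡ value I φ
    exchange-value = trans (reroute-value φ j (shiftMass i u ε))
                           (trans (cong (value I φ +_) (sumFin-shiftMass i u ε)) (+-identityʳ _))

    exchange-ft : ∀ l → ft (exchange i u j ε φ) l ≡ ft φ l
    exchange-ft l = trans (cong (λ s → ft φ l + pointMass j s l) (sumFin-shiftMass i u ε))
                          (trans (cong (ft φ l +_) (pointMass-zero j l)) (+-identityʳ _))

    exchange-fe : ∀ k {l} → l ≢ j → fe (exchange i u j ε φ) k l ≡ fe φ k l
    exchange-fe k l≢j = +-pointMass-≢ _ _ l≢j

    exchange-feasible : ∀ {p} → Feasible I p φ → u ≢ i → E u j ≡ true → E i j ≡ true →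
                        0ℚ ≤ ε → ε ≤ capS I p u - fs φ u → ε ≤ fe φ i j →
                        Feasible I p (exchange i u j ε φ)
    exchange-feasible F u≢i eu ei 0≤ε ε≤slack ε≤fe =
      reroute-feasible j (shiftMass i u ε) F
        (admissible-shiftMass F u≢i (admissible-increase F eu 0≤ε ε≤slack)
                                    (admissible-decrease F ei 0≤ε ε≤fe))
        (subst (0ℚ ≤_) (sym ft-same) (Feasible.ft-nonneg F j))
        (subst (_≤ cB j) (sym ft-same) (Feasible.ft-cap F j))
      where
      ft-same : ft φ j + sumFin (shiftMass i u ε) ≡ ft φ j
      ft-same = trans (cong (ft φ j +_) (sumFin-shiftMass i u ε)) (+-identityʳ _)

  augmentingPath⇒improvable : ∀ {p φ u ns} → Feasible I p φ → fs φ u < capS I p u →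
                              Walk I p φ (a u) snk ns → Unique (src ∷ ns) → Improvable p φ
  augmentingPath⇒improvable F _ (step (bwdS _ _) w) ((_ ∷ src∉w) ∷ _) =
    ⊥-elim (lookup src∉w (headIn w) refl)
  augmentingPath⇒improvable F fs<cap (step (fwdE _ j e) (step (fwdT _ ft<c) _)) _ =
    directPath⇒improvable F fs<cap e ft<c
  augmentingPath⇒improvable {p} {φ} {u} {_ ∷ _ ∷ ms} F fs<cap (step (fwdE _ j e) (step (bwdE i _ e′ 0<fe) w))
    ((_ ∷ _ ∷ src∉w) ∷ (_ ∷ au∉w) ∷ bj∉w ∷ Uw) =
    improvable-resp-value {φ = φ} {φ′} (exchange-value i u j ε φ)
      (augmentingPath⇒improvable {u = i} F′ fs′<cap
        (walk-transport w (λ m → lookup src∉w m refl) fe-same ft-same) (src∉w ∷ Uw))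
    where
    slack : ℚ
    slack = capS I p u - fs φ u
    ε : ℚ
    ε = slack ⊓ fe φ i j
    0<ε : 0ℚ < ε
    0<ε = 0<p⊓q (p<q⇒0<q-p fs<cap) 0<fe
    u≢i : u ≢ i
    u≢i u≡i = lookup au∉w (headIn w) (cong a u≡i)
    φ′ : Flow I
    φ′ = exchange i u j ε φ
    F′ : Feasible I p φ′
    F′ = exchange-feasible i u j ε φ F u≢i e e′ (<⇒≤ 0<ε) (p⊓q≤p slack (fe φ i j)) (p⊓q≤q slack (fe φ i j))
    fs′<cap : fs φ′ i < capS I p i
    fs′<cap = subst (_< capS I p i) (sym (cong (fs φ i +_) (shiftMass-source ε u≢i)))
                    (<-≤-trans (p-q<p _ 0<ε) (Feasible.fs-cap F i))
    fe-same : ∀ k l → b l ∈ ms → fe φ′ k l ≡ fe φ k l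
    fe-same k l m = exchange-fe i u j ε φ k (λ l≡j → lookup bj∉w m (cong b (sym l≡j)))
    ft-same : ∀ l → b l ∈ ms → ft φ′ l ≡ ft φ l
    ft-same l _ = exchange-ft i u j ε φ l

  -- The invariant

  record Cut (p : Prices I) (φ : Flow I) : Set₁ where
    field
      S           : Node I → Set
      src∈S       : S src
      snk∉S       : ¬ S snk
      priceable∉S : ∀ v → priceable v ≡ true → ¬ S (a v)
      closed      : ∀ {x y} → Arc I p φ x y → S x → S y

  Reach : Prices I → Flow I → Node I → Set
  Reach p φ x = Σ (List (Node I)) (Walk I p φ src x)

  maxFlow⇒¬reach-snk : ∀ {p φ} → MaxFlow I p φ → ¬ Reach p φ snk
  maxFlow⇒¬reach-snk M (_ , w) with simplify w
  ... | _ , step (fwdS _ fs<cap) w′ , U =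
    maxFlow⇒¬improvable M (augmentingPath⇒improvable (proj₁ M) fs<cap w′ U)

  zeroPriced⇒noArcInto : ∀ {p φ v x} → Feasible I p φ → priceable v ≡ true → p v ≡ 0ℚ →
                         ¬ Arc I p φ x (a v)
  zeroPriced⇒noArcInto {p} {φ} {v} F pv pv≡0 = λ where
      (fwdS _ fs<cap)   → <-irrefl refl (≤-<-trans (fs-nonneg v) (subst (fs φ v <_) cap≡0 fs<cap))
      (bwdE _ l _ 0<fe) → <-irrefl refl (<-≤-trans 0<fe (≤-trans (fe≤fs F v l) fs≤0))
    where
    open Feasible F
    cap≡0 : capS I p v ≡ 0ℚ
    cap≡0 = trans (capS-priceable p pv) pv≡0
    fs≤0 : fs φ v ≤ 0ℚ
    fs≤0 = subst (fs φ v ≤_) cap≡0 (fs-cap v)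

  startCut : ∀ {φ} → MaxFlow I (zeroPrices I) φ → Cut (zeroPrices I) φ
  startCut {φ} M = record
    { S           = Reach (zeroPrices I) φ
    ; src∈S       = _ , here
    ; snk∉S       = maxFlow⇒¬reach-snk M
    ; priceable∉S = unreachable
    ; closed      = λ e (_ , w) → _ , snoc w e
    }
    where
    unreachable : ∀ v → priceable v ≡ true → ¬ Reach (zeroPrices I) φ (a v)
    unreachable v pv (_ , w)
      with noArcInto⇒walk-trivial (zeroPriced⇒noArcInto (proj₁ M) pv refl) w
    ... | ()

  updA-≡ : ∀ {n} (f : Fin n → ℚ) i x → updA I f i x i ≡ x
  updA-≡ f i x with i ≟ᶠ i
  ... | yes _   = refl
  ... | no  i≢i = ⊥-elim (i≢i refl)

  updA-≢ : ∀ {n} (f : Fin n → ℚ) i x {k} → k ≢ i → updA I f i x k ≡ f k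
  updA-≢ f i x {k} k≢i with k ≟ᶠ i
  ... | yes k≡i = ⊥-elim (k≢i k≡i)
  ... | no  _   = refl

  updE-≢ : ∀ f i j x k {l} → l ≢ j → updE I f i j x k l ≡ f k l
  updE-≢ f i j x k {l} l≢j with k ≟ᶠ i | l ≟ᶠ j
  ... | _     | yes l≡j = ⊥-elim (l≢j l≡j)
  ... | yes _ | no  _   = refl
  ... | no  _ | no  _   = refl

  module _ (δ : ℚ) where

    push-preserves : ∀ {A : Set} (obs : Flow I → A) (n : Node I) →
                     (∀ {p φ x y} (e : Arc I p φ x y) ψ → n ≢ x → n ≢ y → obs (pushArc I δ e ψ) ≡ obs ψ) →
                     ∀ {p φ x y ns} (w : Walk I p φ x y ns) → n ∉ ns → ∀ ψ → obs (push I δ w ψ) ≡ obs ψ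
    push-preserves obs n arc-pres here       n∉ ψ = refl
    push-preserves obs n arc-pres (step e w) n∉ ψ =
      trans (push-preserves obs n arc-pres w (n∉ ∘ there) _)
            (arc-pres e ψ (n∉ ∘ here) (λ { refl → n∉ (there (headIn w)) }))

    pushArc-fs : ∀ k {p φ x y} (e : Arc I p φ x y) ψ → src ≢ x → src ≢ y → fs (pushArc I δ e ψ) k ≡ fs ψ k
    pushArc-fs k (fwdS _ _)     ψ s≢x _   = ⊥-elim (s≢x refl)
    pushArc-fs k (bwdS _ _)     ψ _   s≢y = ⊥-elim (s≢y refl)
    pushArc-fs k (fwdE _ _ _)   ψ _   _   = refl
    pushArc-fs k (bwdE _ _ _ _) ψ _   _   = refl
    pushArc-fs k (fwdT _ _)     ψ _   _   = refl
    pushArc-fs k (bwdT _ _)     ψ _   _   = refl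

    pushArc-fe : ∀ k l {p φ x y} (e : Arc I p φ x y) ψ → b l ≢ x → b l ≢ y → fe (pushArc I δ e ψ) k l ≡ fe ψ k l
    pushArc-fe k l (fwdS _ _)     ψ _   _   = refl
    pushArc-fe k l (bwdS _ _)     ψ _   _   = refl
    pushArc-fe k l (fwdE i j _)   ψ _   l≢y = updE-≢ (fe ψ) i j _ k (l≢y ∘ cong b)
    pushArc-fe k l (bwdE i j _ _) ψ l≢x _   = updE-≢ (fe ψ) i j _ k (l≢x ∘ cong b)
    pushArc-fe k l (fwdT _ _)     ψ _   _   = refl
    pushArc-fe k l (bwdT _ _)     ψ _   _   = refl

    pushArc-ft : ∀ l {p φ x y} (e : Arc I p φ x y) ψ → b l ≢ x → b l ≢ y → ft (pushArc I δ e ψ) l ≡ ft ψ l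
    pushArc-ft l (fwdS _ _)     ψ _   _   = refl
    pushArc-ft l (bwdS _ _)     ψ _   _   = refl
    pushArc-ft l (fwdE _ _ _)   ψ _   _   = refl
    pushArc-ft l (bwdE _ _ _ _) ψ _   _   = refl
    pushArc-ft l (fwdT j _)     ψ l≢x _   = updA-≢ (ft ψ) j _ (l≢x ∘ cong b)
    pushArc-ft l (bwdT j _)     ψ _   l≢y = updA-≢ (ft ψ) j _ (l≢y ∘ cong b)

  step-cut : ∀ {p φ p′ φ′} → Cut p φ → Step I p φ p′ φ′ → Cut p′ φ′
  step-cut {p} {φ} cut (augment v pv {ns} w _ {δ} _) = record
    { S = S ; src∈S = src∈S ; snk∉S = snk∉S ; priceable∉S = priceable∉S ; closed = closed′ }
    where
    open Cut cut
    φ₁ : Flow I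
    φ₁ = pushS I δ v φ
    p′ : Prices I
    p′ = updA I p v (p v + δ)
    φ′ : Flow I
    φ′ = push I δ w φ₁
    off-path : ∀ {n} → S n → n ∉ ns
    off-path sn n∈ns = lookup (walk-avoids closed snk∉S w) n∈ns sn
    fs′≡ : ∀ k → fs φ′ k ≡ fs φ₁ k
    fs′≡ k = push-preserves δ (λ ψ → fs ψ k) src (pushArc-fs δ k) w (off-path src∈S) φ₁
    new-slack⇒old-slack : ∀ {k} → fs φ′ k < capS I p′ k → Dec (k ≡ v) → S (a k)
    new-slack⇒old-slack {k} fs<cap (yes refl) = ⊥-elim (priceable∉S k pv (closed (fwdS k old-slack) src∈S))
      where
      old-slack : fs φ k < capS I p k
      old-slack = subst (fs φ k <_) (sym (capS-priceable p pv))
        (+-cancelʳ-< δ (subst₂ _<_ (trans (fs′≡ k) (updA-≡ (fs φ) k _))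
                                   (trans (capS-priceable p′ pv) (updA-≡ p k _)) fs<cap))
    new-slack⇒old-slack {k} fs<cap (no k≢v) =
      closed (fwdS k (subst₂ _<_ (trans (fs′≡ k) (updA-≢ (fs φ) v _ k≢v))
                                 (cong (if priceable k then_else cA k) (updA-≢ p v _ k≢v)) fs<cap)) src∈S
    closed′ : ∀ {x y} → Arc I p′ φ′ x y → S x → S y
    closed′ (fwdS k fs<cap) _ = new-slack⇒old-slack fs<cap (k ≟ᶠ v)
    closed′ (bwdS _ _) _ = src∈S
    closed′ (fwdE k l e) sx = closed (fwdE k l e) sx
    closed′ (bwdE k l e 0<fe) sx = closed (bwdE k l e (subst (0ℚ <_) fe′≡ 0<fe)) sx
      where
      fe′≡ : fe φ′ k l ≡ fe φ₁ k l
      fe′≡ = push-preserves δ (λ ψ → fe ψ k l) (b l) (pushArc-fe δ k l) w (off-path sx) φ₁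
    closed′ (fwdT l ft<c) sx = closed (fwdT l (subst (_< cB l) ft′≡ ft<c)) sx
      where
      ft′≡ : ft φ′ l ≡ ft φ₁ l
      ft′≡ = push-preserves δ (λ ψ → ft ψ l) (b l) (pushArc-ft δ l) w (off-path sx) φ₁
    closed′ (bwdT _ _) snk∈S = ⊥-elim (snk∉S snk∈S)

  reachable⇒cut : ∀ {p φ} → Reachable I p φ → Cut p φ
  reachable⇒cut (start φ M) = startCut M
  reachable⇒cut (next R s)  = step-cut (reachable⇒cut R) s

-- Reachability of a v from s alone is contradictory.
lemma4p3 : (I : Instance) (p : Prices I) (φ : Flow I) →
    Reachable I p φ →
    (v : Fin (Instance.nA I)) → Instance.priceable I v ≡ true →
    ¬ FixedPath I p φ v
lemma4p3 I p φ R v pv (u , w , ms , _ , s→u , u⇝w , w→v , _) =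
  priceable∉S v pv (closed w→v (walk-closed I closed u⇝w (closed s→u src∈S)))
  where open Cut (reachable⇒cut I R)
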